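{- Suppose that $P$ is a $0$-$1$ matrix that contains at least one of the following matrices: $\begin{bmatrix} 0 & 1 & 0 \\ 1 & 0 & 1 \end{bmatrix}, \begin{bmatrix} 0 & 0 & 1 \\ 1 & 1 & 0 \end{bmatrix}, \begin{bmatrix} 0 & 1 \\ 1 & 1 \end{bmatrix}, \begin{bmatrix} 0 & 0 & 1 \\ 1 & 0 & 0 \\ 0 & 1 & 0 \end{bmatrix}$. Then $sm(m,P) = \Omega(m^{1/2})$.
   Context: A $0$-$1$ matrix $A$ contains a $0$-$1$ matrix $P$ if some submatrix of $A$ (obtained by selecting a subset of rows and a subset of columns, preserving order) either equals $P$ or can be changed into $P$ by turning some ones into zeroes; otherwise $A$ avoids $P$. For $0$-$1$ matrices $A, P$, $LSM(A,P)$ is the maximum number of ones in a $P$-avoiding $0$-$1$ matrix $B$ that is contained in $A$. $sm(m,P)$ is the minimum of $LSM(A,P)$ over all $0$-$1$ matrices $A$ with exactly $m$ ones. -}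

module Defs where

open import Data.Nat using (ℕ; zero; suc; _+_; _*_; _≤_; _<_)
open import Data.Bool using (Bool; true; false)
open import Data.Fin using (Fin; toℕ) renaming (_<_ to _<ᶠ_)
open import Data.Fin.Patterns using (0F; 1F; 2F)
open import Data.List using (List; map; allFin)
open import Data.Nat.ListAction using (sum)
open import Data.Product using (Σ; ∃; _×_; _,_)
open import Relation.Binary.PropositionalEquality using (_≡_)
open import Relation.Nullary using (¬_)

record Matrix : Set where
  constructor mat
  field
    rows : ℕ
    cols : ℕ
    entry : Fin rows → Fin cols → Bool
open Matrix public

bit : Bool → ℕ
bit true = 1
bit false = 0

ones : Matrix → ℕ
ones M = sum (map (λ i → sum (map (λ j → bit (entry M i j)) (allFin (cols M)))) (allFin (rows M)))

StrictlyIncreasing : {a b : ℕ} → (Fin a → Fin b) → Set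
StrictlyIncreasing f = ∀ i j → i <ᶠ j → f i <ᶠ f j

_Contains_ : Matrix → Matrix → Set
A Contains P =
  Σ (Fin (rows P) → Fin (rows A)) λ f →
  Σ (Fin (cols P) → Fin (cols A)) λ g →
  StrictlyIncreasing f × StrictlyIncreasing g ×
  (∀ i j → entry P i j ≡ true → entry A (f i) (g j) ≡ true)

_Avoids_ : Matrix → Matrix → Set
A Avoids P = ¬ (A Contains P)

-- LSM(A,P) ≥ s : there is a P-avoiding B contained in A with at least s ones.
-- (LSM(A,P) is the maximum of ones B over such B; this is "max ≥ s".)
LSM≥ : Matrix → Matrix → ℕ → Set
LSM≥ A P s = Σ Matrix λ B → (A Contains B) × (B Avoids P) × (s ≤ ones B)

-- sm(m,P) ≥ s : every A with exactly m ones has LSM(A,P) ≥ s.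
-- (sm(m,P) is the minimum of LSM(A,P) over such A; this is "min ≥ s".)
sm≥ : ℕ → Matrix → ℕ → Set
sm≥ m P s = ∀ (A : Matrix) → ones A ≡ m → LSM≥ A P s

Q₁ : Matrix
Q₁ = mat 2 3 e
  where
  e : Fin 2 → Fin 3 → Bool
  e 0F 1F = true
  e 1F 0F = true
  e 1F 2F = true
  e _ _ = false

Q₂ : Matrix
Q₂ = mat 2 3 e
  where
  e : Fin 2 → Fin 3 → Bool
  e 0F 2F = true
  e 1F 0F = true
  e 1F 1F = true
  e _ _ = false

Q₃ : Matrix
Q₃ = mat 2 2 e
  where
  e : Fin 2 → Fin 2 → Bool
  e 0F 1F = true
  e 1F 0F = true
  e 1F 1F = true
  e _ _ = false

Q₄ : Matrix
Q₄ = mat 3 3 e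
  where
  e : Fin 3 → Fin 3 → Bool
  e 0F 2F = true
  e 1F 0F = true
  e 2F 1F = true
  e _ _ = false

-- Every Qᵢ contains both an inversion (the pattern [0 1 ; 1 0]) and a weak ascent (two ones
-- in one row, or the pattern [1 0 ; 0 1]), so P does too. Peel A repeatedly, each time
-- removing its undominated ones: those with no other one strictly north-east of them. A
-- removed layer has no inversion, hence avoids P. If none of the first s layers has more
-- than s ones while A has more than s² ones, some one survives s peelings, and following
-- dominating ones from it gives s + 1 ones of A, each strictly north-east of the previous.
-- So A contains the (s+1)×(s+1) anti-diagonal matrix, which has no weak ascent and avoids
-- P. Taking s + 1 = ⌊√m⌋ gives sm(m,P) ≥ ⌊√m⌋ ≥ √m / 2.
module Submission where

open import Defs
open import Data.Bool using (Bool; true; false; _∧_; not)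
open import Data.Bool.Properties using () renaming (_≟_ to _≟ᵇ_)
open import Data.Fin using (Fin; zero; suc; opposite; _≟_) renaming (_<_ to _<ᶠ_; _≤_ to _≤ᶠ_)
open import Data.Fin.Patterns using (0F; 1F; 2F)
open import Data.Fin.Properties
  using (any?; opposite-prop; toℕ<n; <-trans; ≤∧≢⇒<) renaming (_<?_ to _<ᶠ?_)
open import Data.List using (map; allFin; tabulate)
open import Data.List.Properties using (map-tabulate)
open import Data.Nat using (ℕ; zero; suc; _+_; _*_; _<_; _≤_; z≤n; s≤s; z<s; s<s; s<s⁻¹)
open import Data.Nat.ListAction using (sum)
open import Data.Nat.Properties
  using ( +-0-commutativeMonoid; ≤-refl; ≤-reflexive; ≤-antisym; ≤-trans; <-≤-trans
        ; <⇒≤; <⇒≱; ≮⇒≥; n<1+n; m≤n+m; m≤n⇒m≤1+n; _<?_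
        ; +-assoc; +-comm; +-identityʳ; +-monoʳ-≤; +-monoˡ-≤; +-cancelˡ-<
        ; *-mono-≤; *-mono-<; ∸-monoʳ-≤; ∸-monoʳ-<; module ≤-Reasoning )
open import Data.Nat.Solver using (module +-*-Solver)
open import Algebra.Properties.CommutativeMonoid.Sum +-0-commutativeMonoid
  using (sum-syntax; sum-cong-≗; ∑-distrib-+; sum-replicate-zero)
open import Data.Product using (Σ; ∃; _×_; _,_; proj₁; proj₂)
open import Data.Sum using (_⊎_; inj₁; inj₂)
open import Data.Vec.Functional using (_∷_)
open import Function using (id; _∘_)
open import Relation.Binary.PropositionalEquality
open import Relation.Nullary using (Dec; does; yes; no; ¬_; ¬?; _×-dec_; contradiction)
open import Relation.Nullary.Decidable using (map′)

sum-map-allFin : ∀ n (f : Fin n → ℕ) → sum (map f (allFin n)) ≡ ∑[ i < n ] f i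
sum-map-allFin n f = trans (cong sum (map-tabulate id f)) (sum-tabulate n f)
  where
  sum-tabulate : ∀ n (f : Fin n → ℕ) → sum (tabulate f) ≡ ∑[ i < n ] f i
  sum-tabulate zero    f = refl
  sum-tabulate (suc n) f = cong (f zero +_) (sum-tabulate n (f ∘ suc))

∑-positive : ∀ {n} (f : Fin n → ℕ) → 0 < ∑[ i < n ] f i → ∃ λ i → 0 < f i
∑-positive {suc n} f ∑f>0 with f zero in f₀≡
... | suc _ = zero , subst (0 <_) (sym f₀≡) z<s
... | zero  = let i , fᵢ>0 = ∑-positive (f ∘ suc) ∑f>0 in suc i , fᵢ>0

∑-const-1 : ∀ n → ∑[ i < n ] 1 ≡ n
∑-const-1 zero    = refl
∑-const-1 (suc n) = cong suc (∑-const-1 n)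

∑-indicator : ∀ {n} (c : Fin n) → ∑[ j < n ] bit (does (j ≟ c)) ≡ 1
∑-indicator {suc n} zero    = cong suc (sum-replicate-zero n)
∑-indicator {suc n} (suc c) = ∑-indicator c

count : ∀ {r c} → (Fin r → Fin c → Bool) → ℕ
count {r} {c} R = ∑[ i < r ] ∑[ j < c ] bit (R i j)

ones≡count : ∀ M → ones M ≡ count (entry M)
ones≡count M = trans (sum-map-allFin (rows M) _) (sum-cong-≗ {rows M} λ i → sum-map-allFin (cols M) _)

bit-positive : ∀ {x} → 0 < bit x → x ≡ true
bit-positive {true} _ = refl

bit-split : ∀ x y → bit x ≡ bit (x ∧ not y) + bit (x ∧ y)
bit-split true  true  = refl
bit-split true  false = refl
bit-split false _     = refl

∧-true⁻¹ : ∀ {x y} → x ∧ y ≡ true → x ≡ true × y ≡ true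
∧-true⁻¹ {true} {true} _ = refl , refl

dec-true⁻¹ : ∀ {a} {A : Set a} (a? : Dec A) → does a? ≡ true → A
dec-true⁻¹ (yes a) _ = a

Inversion : Matrix → Set
Inversion M =
  Σ (Fin (rows M)) λ i → Σ (Fin (rows M)) λ i' → Σ (Fin (cols M)) λ j → Σ (Fin (cols M)) λ j' →
  i <ᶠ i' × j' <ᶠ j × entry M i j ≡ true × entry M i' j' ≡ true

WeakAscent : Matrix → Set
WeakAscent M =
  Σ (Fin (rows M)) λ i → Σ (Fin (rows M)) λ i' → Σ (Fin (cols M)) λ j → Σ (Fin (cols M)) λ j' →
  i ≤ᶠ i' × j <ᶠ j' × entry M i j ≡ true × entry M i' j' ≡ true

strictlyIncreasing⇒monotone : ∀ {a b} {f : Fin a → Fin b} → StrictlyIncreasing f →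
  ∀ {i j} → i ≤ᶠ j → f i ≤ᶠ f j
strictlyIncreasing⇒monotone f↑ {i} {j} i≤j with i ≟ j
... | yes refl = ≤-refl
... | no  i≢j  = <⇒≤ (f↑ i j (≤∧≢⇒< i≤j i≢j))

contains-Inversion : ∀ {A B} → A Contains B → Inversion B → Inversion A
contains-Inversion (f , g , f↑ , g↑ , A⊇B) (i , i' , j , j' , i<i' , j'<j , Bij , Bi'j') =
  f i , f i' , g j , g j' , f↑ i i' i<i' , g↑ j' j j'<j , A⊇B i j Bij , A⊇B i' j' Bi'j'

contains-WeakAscent : ∀ {A B} → A Contains B → WeakAscent B → WeakAscent A
contains-WeakAscent (f , g , f↑ , g↑ , A⊇B) (i , i' , j , j' , i≤i' , j<j' , Bij , Bi'j') =
  f i , f i' , g j , g j' , strictlyIncreasing⇒monotone f↑ i≤i' , g↑ j j' j<j' , A⊇B i j Bij , A⊇B i' j' Bi'j'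

Q-Inversion×WeakAscent : ∀ {P} →
  (P Contains Q₁) ⊎ (P Contains Q₂) ⊎ (P Contains Q₃) ⊎ (P Contains Q₄) → Inversion P × WeakAscent P
Q-Inversion×WeakAscent (inj₁ P⊇Q₁) =
  contains-Inversion P⊇Q₁ (0F , 1F , 1F , 0F , z<s , z<s , refl , refl) ,
  contains-WeakAscent P⊇Q₁ (1F , 1F , 0F , 2F , ≤-refl , z<s , refl , refl)
Q-Inversion×WeakAscent (inj₂ (inj₁ P⊇Q₂)) =
  contains-Inversion P⊇Q₂ (0F , 1F , 2F , 0F , z<s , z<s , refl , refl) ,
  contains-WeakAscent P⊇Q₂ (1F , 1F , 0F , 1F , ≤-refl , z<s , refl , refl)
Q-Inversion×WeakAscent (inj₂ (inj₂ (inj₁ P⊇Q₃))) =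
  contains-Inversion P⊇Q₃ (0F , 1F , 1F , 0F , z<s , z<s , refl , refl) ,
  contains-WeakAscent P⊇Q₃ (1F , 1F , 0F , 1F , ≤-refl , z<s , refl , refl)
Q-Inversion×WeakAscent (inj₂ (inj₂ (inj₂ P⊇Q₄))) =
  contains-Inversion P⊇Q₄ (0F , 1F , 2F , 0F , z<s , z<s , refl , refl) ,
  contains-WeakAscent P⊇Q₄ (1F , 2F , 0F , 1F , s≤s z≤n , z<s , refl , refl)

opposite-antimono-≤ : ∀ {n} {i j : Fin n} → i ≤ᶠ j → opposite j ≤ᶠ opposite i
opposite-antimono-≤ {n} {i} {j} i≤j =
  subst₂ _≤_ (sym (opposite-prop j)) (sym (opposite-prop i)) (∸-monoʳ-≤ n (s≤s i≤j))

opposite-antimono-< : ∀ {n} {i j : Fin n} → i <ᶠ j → opposite j <ᶠ opposite i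
opposite-antimono-< {n} {i} {j} i<j =
  subst₂ _<_ (sym (opposite-prop j)) (sym (opposite-prop i)) (∸-monoʳ-< (s<s i<j) (toℕ<n j))

antidiagonal : ℕ → Matrix
antidiagonal n = mat n n λ i j → does (j ≟ opposite i)

ones-antidiagonal : ∀ n → ones (antidiagonal n) ≡ n
ones-antidiagonal n = begin
  ones (antidiagonal n)                       ≡⟨ ones≡count (antidiagonal n) ⟩
  ∑[ i < n ] ∑[ j < n ] bit (does (j ≟ opposite i)) ≡⟨ sum-cong-≗ {n} (∑-indicator ∘ opposite) ⟩
  ∑[ i < n ] 1                                ≡⟨ ∑-const-1 n ⟩
  n                                           ∎
  where open ≡-Reasoning

antidiagonal-noWeakAscent : ∀ n → ¬ WeakAscent (antidiagonal n)
antidiagonal-noWeakAscent n (i , i' , j , j' , i≤i' , j<j' , j≡ , j'≡)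
  rewrite dec-true⁻¹ (j ≟ opposite i) j≡ | dec-true⁻¹ (j' ≟ opposite i') j'≡ =
  <⇒≱ j<j' (opposite-antimono-≤ i≤i')

Mask : ℕ → ℕ → Set
Mask r c = Fin r → Fin c → Bool

Cell : ℕ → ℕ → Set
Cell r c = Fin r × Fin c

module _ {r c : ℕ} where

  infix 4 _∈_ _⊆_ _↗_

  _∈_ : Cell r c → Mask r c → Set
  (i , j) ∈ R = R i j ≡ true

  _⊆_ : Mask r c → Mask r c → Set
  R ⊆ S = ∀ {p} → p ∈ R → p ∈ S

  -- p ↗ q: q lies strictly north-east of p (rows are numbered from the top).
  _↗_ : Cell r c → Cell r c → Set
  (i , j) ↗ (i' , j') = i' <ᶠ i × j <ᶠ j'

  ↗-trans : ∀ {p q u} → p ↗ q → q ↗ u → p ↗ u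
  ↗-trans (i'<i , j<j') (i''<i' , j'<j'') = <-trans i''<i' i'<i , <-trans j<j' j'<j''

  Dominated : Mask r c → Cell r c → Set
  Dominated R p = ∃ λ q → q ∈ R × p ↗ q

  dominated? : ∀ R p → Dec (Dominated R p)
  dominated? R (i , j) =
    map′ (λ (i' , j' , q) → (i' , j') , q) (λ ((i' , j') , q) → i' , j' , q)
      (any? λ i' → any? λ j' → (R i' j' ≟ᵇ true) ×-dec (i' <ᶠ? i) ×-dec (j <ᶠ? j'))

  peel top : Mask r c → Mask r c
  peel R i j = R i j ∧ does (dominated? R (i , j))
  top  R i j = R i j ∧ does (¬? (dominated? R (i , j)))

  peel-dominated : ∀ R {p} → p ∈ peel R → p ∈ R × Dominated R p
  peel-dominated R {p} p∈ = let p∈R , d = ∧-true⁻¹ p∈ in p∈R , dec-true⁻¹ (dominated? R p) d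

  top-undominated : ∀ R {p} → p ∈ top R → p ∈ R × ¬ Dominated R p
  top-undominated R {p} p∈ = let p∈R , ¬d = ∧-true⁻¹ p∈ in p∈R , dec-true⁻¹ (¬? (dominated? R p)) ¬d

  top-antichain : ∀ R {p q} → p ∈ top R → q ∈ top R → ¬ p ↗ q
  top-antichain R p∈ q∈ p↗q =
    proj₂ (top-undominated R p∈) (_ , proj₁ (top-undominated R q∈) , p↗q)

  count-top+peel : ∀ R → count R ≡ count (top R) + count (peel R)
  count-top+peel R =
    trans (sum-cong-≗ {r} λ i → trans (sum-cong-≗ {c} λ j → bit-split (R i j) _) (∑-distrib-+ {c} _ _))
          (∑-distrib-+ {r} _ _)

  peelⁿ : ℕ → Mask r c → Mask r c
  peelⁿ zero    R = R
  peelⁿ (suc k) R = peel (peelⁿ k R)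

  peelⁿ⊆ : ∀ k R → peelⁿ k R ⊆ R
  peelⁿ⊆ zero    R p∈ = p∈
  peelⁿ⊆ (suc k) R p∈ = peelⁿ⊆ k R (proj₁ (peel-dominated (peelⁿ k R) p∈))

  Chain : ∀ {n} → Mask r c → (Fin n → Cell r c) → Set
  Chain R h = (∀ a → h a ∈ R) × (∀ {a b} → a <ᶠ b → h a ↗ h b)

  chain-cons : ∀ {n R p} {h : Fin (suc n) → Cell r c} → p ∈ R → p ↗ h zero → Chain R h → Chain R (p ∷ h)
  chain-cons {R = R} {p} {h} p∈R p↗h₀ (h∈R , h↗) = ∈R , ↗
    where
    ∈R : ∀ a → (p ∷ h) a ∈ R
    ∈R zero    = p∈R
    ∈R (suc a) = h∈R a
    ↗ : ∀ {a b} → a <ᶠ b → (p ∷ h) a ↗ (p ∷ h) b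
    ↗ {zero}  {suc zero}    _   = p↗h₀
    ↗ {zero}  {suc (suc b)} _   = ↗-trans p↗h₀ (h↗ {zero} {suc b} z<s)
    ↗ {suc a} {suc b}       a<b = h↗ (s<s⁻¹ a<b)

  peelⁿ⇒chain : ∀ k R {p} → p ∈ peelⁿ k R → ∃ λ (h : Fin k → Cell r c) → Chain R (p ∷ h)
  peelⁿ⇒chain zero    R p∈ = (λ ()) , (λ { zero → p∈ }) , λ { {zero} {zero} () }
  peelⁿ⇒chain (suc k) R p∈ with peel-dominated (peelⁿ k R) p∈
  ... | p∈peelⁿ , q , q∈peelⁿ , p↗q =
    let h , chain = peelⁿ⇒chain k R q∈peelⁿ
    in (_ ∷ h) , chain-cons (peelⁿ⊆ k R p∈peelⁿ) p↗q chain

  count-positive : ∀ {R} → 0 < count R → ∃ λ p → p ∈ R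
  count-positive pos =
    let i , row>0 = ∑-positive _ pos
        j , bit>0 = ∑-positive _ row>0
    in (i , j) , bit-positive bit>0

  wideLayer-or-fewPeeled : ∀ s k R →
    (∃ λ t → s < count (top (peelⁿ t R))) ⊎ count R ≤ k * s + count (peelⁿ k R)
  wideLayer-or-fewPeeled s zero    R = inj₂ ≤-refl
  wideLayer-or-fewPeeled s (suc k) R with wideLayer-or-fewPeeled s k R | s <? count (top (peelⁿ k R))
  ... | inj₁ wide  | _         = inj₁ wide
  ... | inj₂ _     | yes wide  = inj₁ (k , wide)
  ... | inj₂ bound | no narrow = inj₂ (begin
    count R                                                      ≤⟨ bound ⟩
    k * s + count (peelⁿ k R)                                    ≡⟨ cong (k * s +_) (count-top+peel (peelⁿ k R)) ⟩
    k * s + (count (top (peelⁿ k R)) + count (peelⁿ (suc k) R))  ≤⟨ +-monoʳ-≤ (k * s) (+-monoˡ-≤ _ (≮⇒≥ narrow)) ⟩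
    k * s + (s + count (peelⁿ (suc k) R))                        ≡⟨ sym (+-assoc (k * s) s _) ⟩
    (k * s + s) + count (peelⁿ (suc k) R)                        ≡⟨ cong (_+ count (peelⁿ (suc k) R)) (+-comm (k * s) s) ⟩
    suc k * s + count (peelⁿ (suc k) R)                          ∎)
    where open ≤-Reasoning

  wideLayer-or-chain : ∀ k s R → k * s < count R →
    (∃ λ t → s < count (top (peelⁿ t R))) ⊎ (∃ λ (h : Fin (suc k) → Cell r c) → Chain R h)
  wideLayer-or-chain k s R ks<count with wideLayer-or-fewPeeled s k R
  ... | inj₁ wide  = inj₁ wide
  ... | inj₂ bound =
    let p , p∈ = count-positive {peelⁿ k R} peeled-nonempty
        h , chain = peelⁿ⇒chain k R p∈
    in inj₂ (p ∷ h , chain)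
    where
    peeled-nonempty : 0 < count (peelⁿ k R)
    peeled-nonempty = +-cancelˡ-< (k * s) 0 _
      (subst (_< k * s + count (peelⁿ k R)) (sym (+-identityʳ (k * s))) (<-≤-trans ks<count bound))

contains-⊆ : ∀ A {R : Mask (rows A) (cols A)} → R ⊆ entry A → A Contains mat (rows A) (cols A) R
contains-⊆ A R⊆A = id , id , (λ _ _ → id) , (λ _ _ → id) , λ i j → R⊆A

antichain⇒¬Inversion : ∀ {r c} {R : Mask r c} → (∀ {p q} → p ∈ R → q ∈ R → ¬ p ↗ q) → ¬ Inversion (mat r c R)
antichain⇒¬Inversion antichain (i , i' , j , j' , i<i' , j'<j , Rij , Ri'j') = antichain Ri'j' Rij (i<i' , j'<j)

chain⇒antidiagonal : ∀ {n} A {h : Fin n → Cell (rows A) (cols A)} → Chain (entry A) h → A Contains antidiagonal n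
chain⇒antidiagonal A {h} (h∈A , h↗) = proj₁ ∘ h ∘ opposite , proj₂ ∘ h , rows↑ , cols↑ , entries
  where
  rows↑ : StrictlyIncreasing (proj₁ ∘ h ∘ opposite)
  rows↑ x x' x<x' = proj₁ (h↗ (opposite-antimono-< x<x'))
  cols↑ : StrictlyIncreasing (proj₂ ∘ h)
  cols↑ y y' y<y' = proj₂ (h↗ y<y')
  entries : ∀ x y → does (y ≟ opposite x) ≡ true → entry A (proj₁ (h (opposite x))) (proj₂ (h y)) ≡ true
  entries x y y≡ rewrite dec-true⁻¹ (y ≟ opposite x) y≡ = h∈A (opposite x)

square<ones⇒LSM≥-suc : ∀ {P} → Inversion P → WeakAscent P → ∀ A s → s * s < ones A → LSM≥ A P (suc s)
square<ones⇒LSM≥-suc invP ascP A s s²<ones with wideLayer-or-chain s s (entry A) (subst (s * s <_) (ones≡count A) s²<ones)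
... | inj₁ (t , wide) =
  layer ,
  contains-⊆ A (λ p∈ → peelⁿ⊆ t (entry A) (proj₁ (top-undominated peeled p∈))) ,
  (λ layer⊇P → antichain⇒¬Inversion (top-antichain peeled) (contains-Inversion layer⊇P invP)) ,
  subst (s <_) (sym (ones≡count layer)) wide
  where
  peeled : Mask (rows A) (cols A)
  peeled = peelⁿ t (entry A)
  layer : Matrix
  layer = mat (rows A) (cols A) (top peeled)
... | inj₂ (h , chain) =
  antidiagonal (suc s) ,
  chain⇒antidiagonal A chain ,
  (λ D⊇P → antidiagonal-noWeakAscent (suc s) (contains-WeakAscent D⊇P ascP)) ,
  ≤-reflexive (sym (ones-antidiagonal (suc s)))

floor-sqrt : ∀ m → ∃ λ s → s * s ≤ m × m < suc s * suc s
floor-sqrt zero = 0 , z≤n , z<s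
floor-sqrt (suc m) with floor-sqrt m
... | s , s²≤m , m<[s+1]² with suc m <? suc s * suc s
...   | yes m+1<[s+1]² = s , m≤n⇒m≤1+n s²≤m , m+1<[s+1]²
...   | no  m+1≮[s+1]² =
  suc s , ≤-reflexive (sym m+1≡[s+1]²) ,
  subst (_< suc (suc s) * suc (suc s)) (sym m+1≡[s+1]²) (*-mono-< (n<1+n (suc s)) (n<1+n (suc s)))
  where
  m+1≡[s+1]² : suc m ≡ suc s * suc s
  m+1≡[s+1]² = ≤-antisym m<[s+1]² (≮⇒≥ m+1≮[s+1]²)

sqrt-bracket : ∀ m → 1 ≤ m → ∃ λ s → s * s < m × m ≤ 4 * suc s * suc s
sqrt-bracket m 1≤m with floor-sqrt m
... | zero  , _    , m<1       = contradiction 1≤m (<⇒≱ m<1)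
... | suc s , s²≤m , m<[s+2]² =
  s , <-≤-trans (*-mono-< (n<1+n s) (n<1+n s)) s²≤m , ≤-trans (<⇒≤ m<[s+2]²) [s+2]²≤4[s+1]²
  where
  [s+2]²≤4[s+1]² : (2 + s) * (2 + s) ≤ 4 * suc s * suc s
  [s+2]²≤4[s+1]² = subst (_≤_ _) (solve 1 (λ x → (x :+ x) :* (x :+ x) := con 4 :* x :* x) refl (suc s))
                     (*-mono-≤ s+2≤2[s+1] s+2≤2[s+1])
    where
    open +-*-Solver
    s+2≤2[s+1] : 2 + s ≤ suc s + suc s
    s+2≤2[s+1] = s≤s (m≤n+m (suc s) s)

mainTheorem14 : (P : Matrix) →
    (P Contains Q₁) ⊎ (P Contains Q₂) ⊎ (P Contains Q₃) ⊎ (P Contains Q₄) →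
    Σ ℕ λ K → Σ ℕ λ m₀ → 0 < K ×
      (∀ m → m₀ ≤ m → Σ ℕ λ s → sm≥ m P s × m ≤ K * s * s)
mainTheorem14 P P⊇Q = 4 , 1 , z<s , λ m 1≤m →
  let s , s²<m , m≤4[s+1]² = sqrt-bracket m 1≤m
      invP , ascP = Q-Inversion×WeakAscent P⊇Q
  in suc s , (λ A ones≡m → square<ones⇒LSM≥-suc invP ascP A s (subst (s * s <_) (sym ones≡m) s²<m)) , m≤4[s+1]²
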